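{- Let $G$ be a finite simple graph with vertex set $V(G)=\{v_1,\dots,v_k,\dots,v_n\}$, where $1<k<n$, satisfying: (1) $\bigcup_{i=1}^{k}N[v_i]=V(G)$; (2) $N[v_1]\cap \bigcup_{i=2}^{k}N[v_i]=\emptyset$; (3) $|d(v_i)-d(v_j)|\neq 1$ for every $i\in\{1,\dots,k\}$ and every $j\in\{1,\dots,n\}\setminus\{i\}$; (4) $\{v\in V(G)\mid d(v)=d(v_1)\}=\{v_1\}$; and (5) $\{v\in V(G)\mid d(v)=d(v_i)\}\subseteq\{v_2,\dots,v_k\}$ for every $i\in\{2,\dots,k\}$. Let $G'$ be a finite simple graph with $V(G')=\{v'_1,\dots,v'_n\}$ such that $G-v_j\cong G'-v'_j$ for every $j\in\{1,\dots,n\}$. Then $N[v'_1]\cap \bigcup_{i=2}^{k}N[v'_i]=\emptyset$, where the closed neighbourhoods are taken in $G'$.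
   Context: For a graph $H$ and $v\in V(H)$, $N(v)=\{u\in V(H)\mid uv\in E(H)\}$ is the open neighbourhood, $N[v]=N(v)\cup\{v\}$ the closed neighbourhood, and $d(v)=|N(v)|$ the degree of $v$ in $H$ (here degrees $d(\cdot)$ in the hypotheses are taken in $G$). $H-v$ denotes the graph obtained from $H$ by deleting $v$ and all edges incident to it. -}

module Defs where

open import Data.Nat using (ℕ; suc)
open import Data.Fin using (Fin; punchIn)
open import Data.Fin.Base using (toℕ)
open import Data.List using (length; filterᵇ; allFin)
open import Data.Bool using (Bool; true; false)
open import Data.Product using (Σ; _×_)
open import Data.Sum using (_⊎_)
open import Function.Bundles using (_⤖_; Bijection)
open import Relation.Binary.PropositionalEquality using (_≡_)

-- A finite simple graph on the vertex set Fin n (vertex v_{i+1} is the index i).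
-- Adjacency is Boolean (hence decidable), symmetric and irreflexive (no loops).
record Graph (n : ℕ) : Set where
  field
    adj   : Fin n → Fin n → Bool
    sym   : ∀ u v → adj u v ≡ adj v u
    irref : ∀ v → adj v v ≡ false
open Graph public

deg : ∀ {n} → Graph n → Fin n → ℕ
deg G v = length (filterᵇ (adj G v) (allFin _))

_∈N[_]_ : ∀ {n} → Fin n → Fin n → Graph n → Set
u ∈N[ v ] G = (u ≡ v) ⊎ (adj G v u ≡ true)

-- H - j : delete vertex j; the remaining vertices are relabelled order-preservingly
-- by Fin m via punchIn j.
delete : ∀ {m} → Graph (suc m) → Fin (suc m) → Graph m
delete G j = record
  { adj   = λ a b → adj G (punchIn j a) (punchIn j b)
  ; sym   = λ a b → sym G (punchIn j a) (punchIn j b)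
  ; irref = λ a → irref G (punchIn j a) }

-- graph isomorphism: a bijection of vertex sets preserving adjacency (both ways,
-- since adjacency is Boolean and equality is required)
_≅_ : ∀ {m} → Graph m → Graph m → Set
_≅_ {m} H H' = Σ (Fin m ⤖ Fin m) λ f →
  ∀ a b → adj H a b ≡ adj H' (Bijection.to f a) (Bijection.to f b)

{-# OPTIONS --safe #-}
module Submission where

-- For n ≥ 3 every edge of G lies in exactly n − 2 of the cards G − x, so the cards
-- determine the degree sum of G, and then every degree, d(x) being half the loss of
-- degree sum in passing to G − x.  Now let u ≠ v be adjacent in G'.  In G' − u ≅ G − u
-- the vertex v has degree d(v) − 1, so the vertex w of G corresponding to it has degree
-- d(v) or d(v) − 1 in G, according as w is adjacent to u in G or not.  Condition (3)
-- excludes d(v) − 1 when v is one of v₁, …, v_k, so every member of N[v_i] in G' lies in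
-- N[w] in G for some w of the same degree as v_i.  By (4) and (5) that w is v₁ itself
-- when i = 1 and one of v₂, …, v_k otherwise, and (2) for G gives (2) for G'.

open import Defs hiding (sym)
open import Data.Nat using (ℕ; zero; suc; _+_; _*_; _∸_; _<_; _≤_; ∣_-_∣; ⌊_/2⌋; s≤s; z<s)
open import Data.Nat.Properties
  using (+-assoc; <-trans; +-cancelˡ-≡; +-cancelʳ-≡; *-cancelˡ-≡; 1+n≢n; n≤1+n; m+n∸n≡m;
         m≤n⇒∣n-m∣≡n∸m; n≡⌊n+n/2⌋; +-0-commutativeMonoid)
open import Algebra.Properties.CommutativeMonoid.Sum +-0-commutativeMonoid
  using (sum; sum-remove; sum-permute; sum-cong-≗; ∑-distrib-+)
open import Data.Fin using (Fin; zero; suc; toℕ; punchIn; punchOut)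
open import Data.Fin.Properties using (punchIn-punchOut)
open import Data.Bool using (Bool; true; false)
open import Data.List using (length; filterᵇ; tabulate)
open import Data.Product using (Σ; ∃-syntax; _×_; _,_; proj₁; proj₂)
open import Data.Sum using (inj₁; inj₂)
open import Data.Empty using (⊥-elim)
open import Function using (_∘_; id)
open import Function.Bundles using (Bijection)
open import Function.Properties.Bijection using (⤖⇒↔)
open import Relation.Binary.PropositionalEquality
  using (_≡_; _≢_; refl; sym; trans; cong; cong₂; subst; module ≡-Reasoning)
open import Relation.Nullary using (¬_)

open ≡-Reasoning

indicator : Bool → ℕ
indicator true  = 1
indicator false = 0

length-filterᵇ-tabulate : ∀ {a} {A : Set a} {n} (p : A → Bool) (f : Fin n → A) →
  length (filterᵇ p (tabulate f)) ≡ sum (indicator ∘ p ∘ f)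
length-filterᵇ-tabulate {n = zero}  p f = refl
length-filterᵇ-tabulate {n = suc n} p f with p (f zero)
... | true  = cong suc (length-filterᵇ-tabulate p (f ∘ suc))
... | false = length-filterᵇ-tabulate p (f ∘ suc)

deg≡sum : ∀ {n} (H : Graph n) v → deg H v ≡ sum (indicator ∘ adj H v)
deg≡sum H v = length-filterᵇ-tabulate (adj H v) id

deg-punchIn : ∀ {m} (G : Graph (suc m)) x a →
  deg G (punchIn x a) ≡ indicator (adj G (punchIn x a) x) + deg (delete G x) a
deg-punchIn G x a = begin
  deg G (punchIn x a)                      ≡⟨ deg≡sum G (punchIn x a) ⟩
  sum (indicator ∘ adj G (punchIn x a))    ≡⟨ sum-remove {i = x} (indicator ∘ adj G (punchIn x a)) ⟩
  indicator (adj G (punchIn x a) x) + sum (indicator ∘ adj (delete G x) a)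
    ≡⟨ cong (indicator (adj G (punchIn x a) x) +_) (deg≡sum (delete G x) a) ⟨
  indicator (adj G (punchIn x a) x) + deg (delete G x) a ∎

deg≡sum-punchIn : ∀ {m} (G : Graph (suc m)) x →
  deg G x ≡ sum (λ a → indicator (adj G x (punchIn x a)))
deg≡sum-punchIn G x = begin
  deg G x                                                       ≡⟨ deg≡sum G x ⟩
  sum (indicator ∘ adj G x)                                     ≡⟨ sum-remove {i = x} (indicator ∘ adj G x) ⟩
  indicator (adj G x x) + sum (λ a → indicator (adj G x (punchIn x a)))
    ≡⟨ cong (λ b → indicator b + sum (λ a → indicator (adj G x (punchIn x a)))) (irref G x) ⟩
  sum (λ a → indicator (adj G x (punchIn x a)))                 ∎

degreeSum : ∀ {n} → Graph n → ℕ
degreeSum H = sum (deg H)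

degreeSum-delete : ∀ {m} (G : Graph (suc m)) x →
  degreeSum G ≡ deg G x + deg G x + degreeSum (delete G x)
degreeSum-delete G x = begin
  degreeSum G                                                ≡⟨ sum-remove {i = x} (deg G) ⟩
  deg G x + sum (deg G ∘ punchIn x)                          ≡⟨ cong (deg G x +_) (sum-cong-≗ (deg-punchIn G x)) ⟩
  deg G x + sum (λ a → indicator (adj G (punchIn x a) x) + deg (delete G x) a)
    ≡⟨ cong (deg G x +_) (∑-distrib-+ (λ a → indicator (adj G (punchIn x a) x)) (deg (delete G x))) ⟩
  deg G x + (sum (λ a → indicator (adj G (punchIn x a) x)) + degreeSum (delete G x))
    ≡⟨ cong (λ s → deg G x + (s + degreeSum (delete G x))) (sum-cong-≗ (λ a → cong indicator (Graph.sym G (punchIn x a) x))) ⟩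
  deg G x + (sum (λ a → indicator (adj G x (punchIn x a))) + degreeSum (delete G x))
    ≡⟨ cong (λ d → deg G x + (d + degreeSum (delete G x))) (deg≡sum-punchIn G x) ⟨
  deg G x + (deg G x + degreeSum (delete G x))               ≡⟨ +-assoc (deg G x) (deg G x) _ ⟨
  deg G x + deg G x + degreeSum (delete G x)                 ∎

sum-const : ∀ n c → sum {n} (λ _ → c) ≡ n * c
sum-const zero    c = refl
sum-const (suc n) c = cong (c +_) (sum-const n c)

sum-degreeSum-delete : ∀ {p} (G : Graph (suc (suc p))) →
  sum (λ x → degreeSum (delete G x)) ≡ p * degreeSum G
sum-degreeSum-delete {p} G = +-cancelˡ-≡ S _ _ (+-cancelˡ-≡ S _ _ (begin
  S + (S + T)                                             ≡⟨ +-assoc S S T ⟨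
  S + S + T                                               ≡⟨ cong (_+ T) (∑-distrib-+ (deg G) (deg G)) ⟨
  sum (λ x → deg G x + deg G x) + T                       ≡⟨ ∑-distrib-+ (λ x → deg G x + deg G x) (degreeSum ∘ delete G) ⟨
  sum (λ x → deg G x + deg G x + degreeSum (delete G x))  ≡⟨ sum-cong-≗ (degreeSum-delete G) ⟨
  sum {suc (suc p)} (λ _ → S)                             ≡⟨ sum-const (suc (suc p)) S ⟩
  S + (S + p * S)                                         ∎))
  where
  S T : ℕ
  S = degreeSum G
  T = sum (λ x → degreeSum (delete G x))

module _ {m} (H H' : Graph m) (iso : H ≅ H') where
  open Bijection (proj₁ iso) using (to)

  ≅⇒deg≡ : ∀ a → deg H a ≡ deg H' (to a)
  ≅⇒deg≡ a = begin
    deg H a                                ≡⟨ deg≡sum H a ⟩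
    sum (indicator ∘ adj H a)              ≡⟨ sum-cong-≗ (cong indicator ∘ proj₂ iso a) ⟩
    sum (indicator ∘ adj H' (to a) ∘ to)   ≡⟨ sum-permute (indicator ∘ adj H' (to a)) (⤖⇒↔ (proj₁ iso)) ⟨
    sum (indicator ∘ adj H' (to a))        ≡⟨ deg≡sum H' (to a) ⟨
    deg H' (to a)                          ∎

  ≅⇒degreeSum≡ : degreeSum H ≡ degreeSum H'
  ≅⇒degreeSum≡ = trans (sum-cong-≗ ≅⇒deg≡) (sym (sum-permute (deg H') (⤖⇒↔ (proj₁ iso))))

Hypomorphic : ∀ {m} → Graph (suc m) → Graph (suc m) → Set
Hypomorphic G G' = ∀ x → delete G x ≅ delete G' x

module _ {p} (G G' : Graph (suc (suc (suc p)))) (hyp : Hypomorphic G G') where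

  degreeSum-delete≡ : ∀ x → degreeSum (delete G x) ≡ degreeSum (delete G' x)
  degreeSum-delete≡ x = ≅⇒degreeSum≡ (delete G x) (delete G' x) (hyp x)

  hypomorphic⇒degreeSum≡ : degreeSum G ≡ degreeSum G'
  hypomorphic⇒degreeSum≡ = *-cancelˡ-≡ _ _ (suc p) (begin
    suc p * degreeSum G                  ≡⟨ sum-degreeSum-delete G ⟨
    sum (λ x → degreeSum (delete G x))   ≡⟨ sum-cong-≗ degreeSum-delete≡ ⟩
    sum (λ x → degreeSum (delete G' x))  ≡⟨ sum-degreeSum-delete G' ⟩
    suc p * degreeSum G'                 ∎)

  hypomorphic⇒deg≡ : ∀ x → deg G x ≡ deg G' x
  hypomorphic⇒deg≡ x = begin
    deg G x                      ≡⟨ n≡⌊n+n/2⌋ (deg G x) ⟩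
    ⌊ deg G x + deg G x /2⌋      ≡⟨ cong ⌊_/2⌋ double≡ ⟩
    ⌊ deg G' x + deg G' x /2⌋    ≡⟨ n≡⌊n+n/2⌋ (deg G' x) ⟨
    deg G' x                     ∎
    where
    double≡ : deg G x + deg G x ≡ deg G' x + deg G' x
    double≡ = +-cancelʳ-≡ (degreeSum (delete G x)) _ _ (begin
      deg G x + deg G x + degreeSum (delete G x)     ≡⟨ degreeSum-delete G x ⟨
      degreeSum G                                    ≡⟨ hypomorphic⇒degreeSum≡ ⟩
      degreeSum G'                                   ≡⟨ degreeSum-delete G' x ⟩
      deg G' x + deg G' x + degreeSum (delete G' x)  ≡⟨ cong (deg G' x + deg G' x +_) (degreeSum-delete≡ x) ⟨
      deg G' x + deg G' x + degreeSum (delete G x)   ∎)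

adj⇒≢ : ∀ {n} (H : Graph n) {u v} → adj H v u ≡ true → u ≢ v
adj⇒≢ H {v = v} vu refl with trans (sym vu) (irref H v)
... | ()

same-degree-neighbour : ∀ {m} (G G' : Graph (suc m)) {x v} →
  delete G x ≅ delete G' x → deg G v ≡ deg G' v → (∀ w → suc (deg G w) ≢ deg G v) →
  adj G' v x ≡ true → ∃[ w ] deg G w ≡ deg G v × adj G w x ≡ true
same-degree-neighbour {m} G G' {x} {v} card≅ degv≡ no-deg-below vx = by-adjacency (adj G w x) refl
  where
  open Bijection (proj₁ card≅) using (to; to⁻; strictlySurjective)
  a : Fin m
  a = punchOut (adj⇒≢ G' vx)

  w : Fin (suc m)
  w = punchIn x (to⁻ a)

  N : ℕ
  N = deg (delete G' x) a

  deg-v : deg G v ≡ suc N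
  deg-v = begin
    deg G v                                          ≡⟨ degv≡ ⟩
    deg G' v                                         ≡⟨ cong (deg G') (punchIn-punchOut _) ⟨
    deg G' (punchIn x a)                             ≡⟨ deg-punchIn G' x a ⟩
    indicator (adj G' (punchIn x a) x) + N           ≡⟨ cong (λ y → indicator (adj G' y x) + N) (punchIn-punchOut _) ⟩
    indicator (adj G' v x) + N                       ≡⟨ cong (λ b → indicator b + N) vx ⟩
    suc N                                            ∎

  deg-w : ∀ {b} → adj G w x ≡ b → deg G w ≡ indicator b + N
  deg-w {b} wx = begin
    deg G w                                          ≡⟨ deg-punchIn G x (to⁻ a) ⟩
    indicator (adj G w x) + deg (delete G x) (to⁻ a) ≡⟨ cong₂ _+_ (cong indicator wx) (≅⇒deg≡ (delete G x) (delete G' x) card≅ (to⁻ a)) ⟩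
    indicator b + deg (delete G' x) (to (to⁻ a))     ≡⟨ cong (λ y → indicator b + deg (delete G' x) y) (proj₂ (strictlySurjective a)) ⟩
    indicator b + N                                  ∎

  by-adjacency : ∀ b → adj G w x ≡ b → ∃[ w ] deg G w ≡ deg G v × adj G w x ≡ true
  by-adjacency true  wx = w , trans (deg-w wx) (sym deg-v) , wx
  by-adjacency false wx = ⊥-elim (no-deg-below w (trans (cong suc (deg-w wx)) (sym deg-v)))

∈N[]-transfer : ∀ {m} (G G' : Graph (suc m)) {u v} → Hypomorphic G G' → deg G v ≡ deg G' v →
  (∀ w → suc (deg G w) ≢ deg G v) → u ∈N[ v ] G' → ∃[ w ] deg G w ≡ deg G v × u ∈N[ w ] G
∈N[]-transfer _ _ {v = v} _ _ _ (inj₁ u≡v) = v , refl , inj₁ u≡v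
∈N[]-transfer G G' {u = u} hyp degv≡ no-deg-below (inj₂ vu)
  with w , degw≡ , wu ← same-degree-neighbour G G' (hyp u) degv≡ no-deg-below vu
  = w , degw≡ , inj₂ wu

∣fi-fj∣≢1⇒1+fj≢fi : ∀ {a} {A : Set a} (f : A → ℕ) {i} →
  (∀ j → j ≢ i → ∣ f i - f j ∣ ≢ 1) → ∀ j → suc (f j) ≢ f i
∣fi-fj∣≢1⇒1+fj≢fi f {i} gap j 1+fj≡fi = gap j j≢i (begin
  ∣ f i - f j ∣          ≡⟨ cong ∣_- f j ∣ 1+fj≡fi ⟨
  ∣ suc (f j) - f j ∣    ≡⟨ m≤n⇒∣n-m∣≡n∸m (n≤1+n (f j)) ⟩
  suc (f j) ∸ f j        ≡⟨ m+n∸n≡m 1 (f j) ⟩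
  1                      ∎)
  where
  j≢i : j ≢ i
  j≢i refl = 1+n≢n 1+fj≡fi

lemma1 : (m k : ℕ) → (G G' : Graph (suc m)) → 1 < k → k < suc m →
  (∀ u → Σ (Fin (suc m)) λ i → (toℕ i < k) × (u ∈N[ i ] G)) →
  (∀ u → u ∈N[ zero ] G → ∀ i → 1 ≤ toℕ i → toℕ i < k → ¬ (u ∈N[ i ] G)) →
  (∀ i j → toℕ i < k → j ≢ i → ∣ deg G i - deg G j ∣ ≢ 1) →
  (∀ v → deg G v ≡ deg G zero → v ≡ zero) →
  (∀ i → 1 ≤ toℕ i → toℕ i < k → ∀ v → deg G v ≡ deg G i → (1 ≤ toℕ v) × (toℕ v < k)) →
  (∀ j → delete G j ≅ delete G' j) →
  ∀ u → u ∈N[ zero ] G' → ∀ i → 1 ≤ toℕ i → toℕ i < k → ¬ (u ∈N[ i ] G')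
lemma1 zero         _ _ _ (s≤s (s≤s _)) (s≤s ())
lemma1 (suc zero)   _ _ _ (s≤s (s≤s _)) (s≤s (s≤s ()))
lemma1 (suc (suc p)) k G G' 1<k _ _ disjoint gap unique₀ closed hyp u u∈N₀ i 1≤i i<k u∈Nᵢ
  = let w , degw≡ , u∈Nw = transfer i<k u∈Nᵢ
        1≤w , w<k         = closed i 1≤i i<k w degw≡
    in disjoint u u∈N₀G w 1≤w w<k u∈Nw
  where
  transfer : ∀ {v} → toℕ v < k → u ∈N[ v ] G' → ∃[ w ] deg G w ≡ deg G v × u ∈N[ w ] G
  transfer {v} v<k = ∈N[]-transfer G G' hyp (hypomorphic⇒deg≡ G G' hyp v)
    (∣fi-fj∣≢1⇒1+fj≢fi (deg G) (λ j → gap v j v<k))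

  u∈N₀G : u ∈N[ zero ] G
  u∈N₀G = let w , degw≡ , u∈Nw = transfer (<-trans z<s 1<k) u∈N₀
          in subst (u ∈N[_] G) (unique₀ w degw≡) u∈Nw
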